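{- Fix $n\geq1$ and $r\geq0$. (i) If $(\mathbf a,\mathbf b)$ are twins of height $r$ for $n$ and $\mathbf a'\in{\Box}\mathbf a$ is such that $\mathbf a'\neq S[\mathbf a]$, then there is $\mathbf b'\in{\Box}\mathbf b$ such that $\mathbf a'$ and $\mathbf b'$ are locally bisimilar. (ii) If $(\mathbf a,\mathbf b)$ are twins of height $r$ for $n$ and $\mathbf b'\in{\Box}\mathbf b$, then there is $\mathbf a'\in{\Box}\mathbf a$ such that $\mathbf a'$ and $\mathbf b'$ are locally bisimilar. (iii) If $1\le i<j\le2^n$, $\mathcal A^n_i$ and $\mathcal B^n_j$ have the same critical height $m>r$, and they are distinguished by $r$, then there is $\mathbf b'\in{\Box}S^r[\mathbf b^n_j]$ such that $S^{r+1}[\mathbf a^n_i]$ and $\mathbf b'$ are locally bisimilar.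
   Context: Models considered are finite Kripke models $(W,R,V)$ with $R$ transitive and irreflexive, whose frame is a tree, equipped with a partial successor function $S$ sending some points to one of their daughters. For a pointed model $(\mathcal M,w)$, ${\Box}(\mathcal M,w)=\{(\mathcal M,v):wRv\}$, and if $S(w)$ is defined, $S[(\mathcal M,w)]=(\mathcal M,S(w))$; $S^r$ denotes $r$-fold iteration. For a rooted model $\mathcal M$ with root $w_0$, $S[\mathcal M]$ is the submodel generated by $S(w_0)$, its critical branch is the maximal sequence $w_0,\dots,w_m$ with $w_{t+1}=S(w_t)$, and $m$ is its critical height. For rooted models $\mathcal M,\mathcal N$ with roots $w,v$, $r$ distinguishes them if $S^r(w),S^r(v)$ differ on the truth of some variable while $S^t(w),S^t(v)$ agree on all variables for every $t<r$. Two pointed models are locally bisimilar if there is a (standard Kripke) bisimulation between the models relating the two points. Adding a fresh root to a model $Z$ means adding a new irreflexive point that $R$-sees every point of $Z$ and satisfies no variable. For $n\geq1$ and $1\le i\le2^n$, models $\mathcal A^n_i,\mathcal B^n_i$ with roots $a^n_i,b^n_i$ are defined by recursion: for every $n\geq0$, (i) if $i\le2^n$: when $n=0$, $\mathcal A^1_1$ is a single point where exactly $p_1$ is true and $\mathcal B^1_1$ a single point where no variable is true (empty $S$); when $n\ge1$, $\mathcal A^{n+1}_i$ (resp. $\mathcal B^{n+1}_i$) is a copy of $\mathcal A^n_i$ (resp. $\mathcal B^n_i$), same $S$, with $p_{n+1}$ additionally true at the root. (ii) if $i=2^n+j$, $1\le j\le2^n$: $\mathcal B^{n+1}_{2^n+j}$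 is obtained by adding a fresh root $b$ to $\bigsqcup_{k=2}^{2^n}S[\mathcal A^{n+1}_k]\sqcup\mathcal B^{n+1}_j$, with successor function $S_{\mathcal B^{n+1}_j}\cup\{(b,b^{n+1}_j)\}$; $\mathcal A^{n+1}_{2^n+j}$ is obtained by adding a fresh root $a$ to $\bigsqcup_{k=2}^{2^n}S[\mathcal A^{n+1}_k]\sqcup\mathcal B^{n+1}_j\sqcup\mathcal A^{n+1}_j$, with successor function $S_{\mathcal A^{n+1}_j}\cup\{(a,a^{n+1}_j)\}$ (for $n=0$ the union over $k$ is empty). Write $\mathbf a^n_i=(\mathcal A^n_i,a^n_i)$, $\mathbf b^n_i=(\mathcal B^n_i,b^n_i)$. Twins of height $r$ for $n$ are pairs $(S^r[\mathbf a^n_i],S^r[\mathbf b^n_i])$ with $1\le i\le2^n$ such that both are defined. -}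

module Defs where

open import Data.Nat using (ℕ; zero; suc; _+_; _∸_; _^_; _≤?_)
open import Data.Fin using (Fin; zero; suc)
open import Data.List using (List; []; _∷_; length; lookup; map; mapMaybe; upTo)
open import Data.List.Membership.Propositional using (_∈_)
open import Data.Maybe using (Maybe; just; nothing; _>>=_)
import Data.Maybe as Maybe
open import Data.Product using (Σ; _×_; _,_; proj₁; proj₂; ∃)
open import Function.Bundles using (_⇔_)
open import Relation.Binary.PropositionalEquality using (_≡_)
open import Relation.Nullary using (¬_; yes; no)
open import Data.Nat using (_<_)

-- Kripke models (W, R, V) with a partial successor function S.
-- Propositional variables are p_k, k : ℕ; V w k means p_k true at w.

record Model : Set₁ where
  field
    W : Set
    R : W → W → Set
    V : W → ℕ → Set
    S : W → Maybe W

open Model public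

record Pointed : Set₁ where
  constructor _,_
  field
    model : Model
    point : W model

open Pointed public

-- standard Kripke bisimulation between two models (S plays no role)
record IsBisimulation (M N : Model) (Z : W M → W N → Set) : Set where
  field
    atoms : ∀ w v → Z w v → ∀ k → V M w k ⇔ V N v k
    forth : ∀ w v w′ → Z w v → R M w w′ → Σ (W N) λ v′ → R N v v′ × Z w′ v′
    back  : ∀ w v v′ → Z w v → R N v v′ → Σ (W M) λ w′ → R M w w′ × Z w′ v′

LocallyBisimilar : Pointed → Pointed → Set₁
LocallyBisimilar (M , w) (N , v) =
  Σ (W M → W N → Set) λ Z → IsBisimulation M N Z × Z w v

Sᵗ : (M : Model) → ℕ → W M → Maybe (W M)
Sᵗ M zero    w = just w
Sᵗ M (suc t) w = Sᵗ M t w >>= S M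

CriticalHeight : Pointed → ℕ → Set
CriticalHeight (M , w₀) m =
  Σ (W M) (λ x → Sᵗ M m w₀ ≡ just x) × Sᵗ M (suc m) w₀ ≡ nothing

Distinguishes : ℕ → Pointed → Pointed → Set
Distinguishes r (M , w) (N , v) =
  Σ (W M) (λ x → Σ (W N) λ y →
      Sᵗ M r w ≡ just x × Sᵗ N r v ≡ just y ×
      Σ ℕ λ k → ¬ (V M x k ⇔ V N y k))
  × (∀ t → t < r → ∀ x y → Sᵗ M t w ≡ just x → Sᵗ N t v ≡ just y →
       ∀ k → V M x k ⇔ V N y k)

-- Finite trees with successor: a node carries the list of variables true
-- at it, its list of daughters, and optionally the index of the daughter
-- that is its S-successor.

data Tree : Set where
  node : List ℕ → (cs : List Tree) → Maybe (Fin (length cs)) → Tree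

labels : Tree → List ℕ
labels (node ps _ _) = ps

-- points of the tree (paths from the root)
data Pos : Tree → Set where
  here  : ∀ {t} → Pos t
  there : ∀ {ps cs s} (c : Fin (length cs)) → Pos (lookup cs c) → Pos (node ps cs s)

sub : ∀ {t} → Pos t → Tree
sub {t} here    = t
sub (there c p) = sub p

graft : ∀ {t} (p : Pos t) → Pos (sub p) → Pos t
graft here        q = q
graft (there c p) q = there c (graft p q)

-- R: proper descendant (transitive closure of the daughter relation)
data Below : ∀ {t} → Pos t → Pos t → Set where
  b-here  : ∀ {ps cs s} (c : Fin (length cs)) (q : Pos (lookup cs c)) →
            Below {node ps cs s} here (there c q)
  b-there : ∀ {ps cs s} (c : Fin (length cs)) {p q : Pos (lookup cs c)} →
            Below p q → Below {node ps cs s} (there c p) (there c q)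

rootSucc : (t : Tree) → Maybe (Pos t)
rootSucc (node ps cs (just c)) = just (there c here)
rootSucc (node ps cs nothing)  = nothing

treeModel : Tree → Model
treeModel t = record
  { W = Pos t
  ; R = Below
  ; V = λ p k → k ∈ labels (sub p)
  ; S = λ p → Maybe.map (graft p) (rootSucc (sub p))
  }

succSub : Tree → Maybe Tree
succSub (node ps cs (just c)) = just (lookup cs c)
succSub (node ps cs nothing)  = nothing

addVar : ℕ → Tree → Tree
addVar k (node ps cs s) = node (k ∷ ps) cs s

addBoth : ℕ → Tree × Tree → Tree × Tree
addBoth k (a , b) = addVar k a , addVar k b

-- The models A^{n+1}_i , B^{n+1}_i  (gen n i = (A^{n+1}_i , B^{n+1}_i)).

mutual
  low : ℕ → ℕ → Tree × Tree
  low zero    i = node (1 ∷ []) [] nothing , node [] [] nothing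
  low (suc n) i = addBoth (suc (suc n)) (gen n i)

  gen : ℕ → ℕ → Tree × Tree
  gen n i with i ≤? 2 ^ n
  ... | yes _ = low n i
  ... | no  _ =
    let j    = i ∸ 2 ^ n
        Aj   = proj₁ (low n j)
        Bj   = proj₂ (low n j)
        -- S[A^{n+1}_k] for k = 2, …, 2^n (each is defined)
        rest = mapMaybe (λ k → succSub (proj₁ (low n k)))
                        (map (2 +_) (upTo (2 ^ n ∸ 1)))
    in node [] (Aj ∷ Bj ∷ rest) (just zero) ,
       node [] (Bj ∷ rest) (just zero)

-- A^n_i and B^n_i as trees (meaningful for n ≥ 1, 1 ≤ i ≤ 2^n)
A : ℕ → ℕ → Tree
A zero    i = node [] [] nothing
A (suc n) i = proj₁ (gen n i)

B : ℕ → ℕ → Tree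
B zero    i = node [] [] nothing
B (suc n) i = proj₂ (gen n i)

𝒜 : ℕ → ℕ → Model
𝒜 n i = treeModel (A n i)

ℬ : ℕ → ℕ → Model
ℬ n i = treeModel (B n i)

aRoot : ∀ n i → W (𝒜 n i)
aRoot n i = here

bRoot : ∀ n i → W (ℬ n i)
bRoot n i = here

module Submission where

-- The models 𝒜ⁿᵢ, ℬⁿᵢ are trees, and a point of a tree model is locally
-- bisimilar to any point generating the same subtree (the relation
-- "sub w ≡ sub v" is a bisimulation).  So all three claims reduce to
-- statements about subtrees, i.e. to combinatorics of the recursion `gen`.
--
-- This gives (i) and (ii).
--   * (iii): by induction on n, if r distinguishes Aⁿᵢ from Bⁿⱼ (i < j) then
--     S^{r+1}[Aⁿᵢ], when defined, is a daughter subtree of S^r[Bⁿⱼ].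

open import Defs
open import Data.Nat using (ℕ; zero; suc; _≤_; _<_; _^_; _∸_; _+_; _≤?_; s≤s; z≤n)
open import Data.Nat.Properties
  using (n<1+n; <-irrefl; ≰⇒>; m<n⇒0<n∸m; m≤n+o⇒m∸n≤o; ∸-monoˡ-<; ∸-monoˡ-≤; <⇒≤; +-identityʳ; m^n>0; ≤-trans; n≤1+n)
open import Data.Product using (Σ; _×_; _,_; proj₁; proj₂; uncurry)
open import Data.Maybe using (Maybe; just; nothing; _>>=_)
import Data.Maybe as Maybe
import Data.Maybe.Relation.Unary.Any as MaybeAny
open import Data.List using (List; []; _∷_; length; lookup; map; mapMaybe; upTo)
open import Data.List.Membership.Propositional using (_∈_)
open import Data.List.Membership.Propositional.Properties using (∈-map⁺; ∈-upTo⁺)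
open import Data.List.Relation.Unary.Any using (here; there)
import Data.List.Relation.Unary.Any as Any
open import Data.List.Relation.Unary.Any.Properties using (lookup-index; mapMaybe⁺; map⁺)
open import Data.Fin using (Fin; zero; suc)
open import Relation.Nullary using (¬_; yes; no)
open import Data.Empty using (⊥-elim)
open import Function.Bundles using (_⇔_; mk⇔; Equivalence)
open import Relation.Binary.PropositionalEquality

-- the trees S[A^{n+1}_k], k = 2, …, 2^n, shared by all models of case (ii)
restT : ℕ → List Tree
restT n = mapMaybe (λ k → succSub (proj₁ (low n k))) (map (2 +_) (upTo (2 ^ n ∸ 1)))

-- B^{n+1}_{2^n+j}
compB : ℕ → ℕ → Tree
compB n j = node [] (proj₂ (low n j) ∷ restT n) (just zero)

-- index arithmetic for case (ii): i = 2^n + j with 1 ≤ j ≤ 2^n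
high-pos : ∀ n i → ¬ i ≤ 2 ^ n → 1 ≤ i ∸ 2 ^ n
high-pos n i np = m<n⇒0<n∸m (≰⇒> np)

high-bound : ∀ n i → i ≤ 2 ^ suc n → i ∸ 2 ^ n ≤ 2 ^ n
high-bound n i le = m≤n+o⇒m∸n≤o i (2 ^ n) (subst (i ≤_) (cong (2 ^ n +_) (+-identityʳ (2 ^ n))) le)

high-mono : ∀ n i j → ¬ i ≤ 2 ^ n → i < j → i ∸ 2 ^ n < j ∸ 2 ^ n
high-mono n i j np lt = ∸-monoˡ-< lt (<⇒≤ (≰⇒> np))

children : Tree → List Tree
children (node _ cs _) = cs

ChildIdx : List Tree → Tree → Set
ChildIdx cs X = Σ (Fin (length cs)) λ k → lookup cs k ≡ X

ChildOf : Tree → Tree → Set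
ChildOf X Y = ChildIdx (children Y) X

rest-member : ∀ n k {X} → 2 ≤ k → k ≤ 2 ^ n → succSub (proj₁ (low n k)) ≡ just X → ChildIdx (restT n) X
rest-member n (suc (suc k)) {X} (s≤s (s≤s _)) le e = Any.index mem , sym (lookup-index mem)
  where
  f : ℕ → Maybe Tree
  f k = succSub (proj₁ (low n k))
  inRange : suc (suc k) ∈ map (2 +_) (upTo (2 ^ n ∸ 1))
  inRange = ∈-map⁺ (2 +_) (∈-upTo⁺ (∸-monoˡ-≤ 1 le))
  mem : X ∈ restT n
  mem = mapMaybe⁺ f _ (map⁺ (Any.map (λ { refl → subst (MaybeAny.Any (X ≡_)) (sym e) (MaybeAny.just refl) }) inRange))

succSub-addVar : ∀ k T → succSub (addVar k T) ≡ succSub T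
succSub-addVar k (node ps cs (just c)) = refl
succSub-addVar k (node ps cs nothing) = refl

-- A^{n+1}_1 has no successor (it is a copy of the one-point A^1_1)
low-one : ∀ n → succSub (proj₁ (low n 1)) ≡ nothing
low-one zero = refl
low-one (suc n) with 1 ≤? 2 ^ n
... | yes _ = trans (succSub-addVar (suc (suc n)) (proj₁ (low n 1))) (low-one n)
... | no 1≰2^n = ⊥-elim (1≰2^n (m^n>0 2 n))

succ-in-rest : ∀ n k → 1 ≤ k → k ≤ 2 ^ n → ∀ X → succSub (proj₁ (low n k)) ≡ just X → ChildIdx (restT n) X
succ-in-rest n (suc zero) _ _ X e with () ← trans (sym (low-one n)) e
succ-in-rest n (suc (suc k)) _ le X e = rest-member n (suc (suc k)) (s≤s (s≤s z≤n)) le e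

sub-graft : ∀ {T} (p : Pos T) q → sub (graft p q) ≡ sub q
sub-graft here q = refl
sub-graft (there c p) q = sub-graft p q

below-split : ∀ {T} {p w : Pos T} → Below p w → Σ (Pos (sub p)) λ q → Below here q × w ≡ graft p q
below-split (b-here c q) = there c q , b-here c q , refl
below-split (b-there c bl) with below-split bl
... | q , b , e = q , b , cong (there c) e

below-graft : ∀ {T} (p : Pos T) {q : Pos (sub p)} → Below here q → Below p (graft p q)
below-graft here b = b
below-graft (there c p) b = b-there c (below-graft p b)

transport : ∀ {T U} → T ≡ U → Pos T → Pos U
transport refl p = p

sub-transport : ∀ {T U} (e : T ≡ U) p → sub (transport e p) ≡ sub p
sub-transport refl p = refl

below-transport : ∀ {T U} (e : T ≡ U) {q : Pos T} → Below here q → Below here (transport e q)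
below-transport refl b = b

sameSub-bisim : ∀ T U → IsBisimulation (treeModel T) (treeModel U) (λ w v → sub w ≡ sub v)
sameSub-bisim T U = record
  { atoms = λ w v e k → mk⇔ (subst (λ X → k ∈ labels X) e) (subst (λ X → k ∈ labels X) (sym e))
  ; forth = λ w v w′ e bl → forth e bl
  ; back = λ w v v′ e bl → back e bl
  }
  where
  forth : ∀ {T U} {w : Pos T} {v : Pos U} {w′} → sub w ≡ sub v → Below w w′ →
          Σ (Pos U) λ v′ → Below v v′ × sub w′ ≡ sub v′
  forth {w = w} {v} e bl with below-split bl
  ... | q , b , refl = graft v (transport e q) , below-graft v (below-transport e b) ,
        trans (sub-graft w q) (trans (sym (sub-transport e q)) (sym (sub-graft v (transport e q))))
  back : ∀ {T U} {w : Pos T} {v : Pos U} {v′} → sub w ≡ sub v → Below v v′ →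
         Σ (Pos T) λ w′ → Below w w′ × sub w′ ≡ sub v′
  back e bl with forth (sym e) bl
  ... | w′ , b , e′ = w′ , b , sym e′

sameSub⇒bisimilar : ∀ {T U} (w : Pos T) (v : Pos U) → sub w ≡ sub v →
                    LocallyBisimilar (treeModel T , w) (treeModel U , v)
sameSub⇒bisimilar {T} {U} w v e = (λ w v → sub w ≡ sub v) , sameSub-bisim T U , e

graft-bisimilar : ∀ {T U} (a : Pos T) (b : Pos U) {q q′} → sub q ≡ sub q′ →
                  LocallyBisimilar (treeModel T , graft a q) (treeModel U , graft b q′)
graft-bisimilar a b {q} {q′} e =
  sameSub⇒bisimilar (graft a q) (graft b q′) (trans (sub-graft a q) (trans e (sym (sub-graft b q′))))

daughter-point : ∀ {X} U → ChildOf X U → Σ (Pos U) λ q → Below here q × sub q ≡ X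
daughter-point (node ps cs s) (k , e) = there k here , b-here k here , e

daughter-bisimilar : ∀ {T U} (x : Pos T) (y : Pos U) → ChildOf (sub x) (sub y) →
                     Σ (Pos U) λ y′ → Below y y′ × LocallyBisimilar (treeModel T , x) (treeModel U , y′)
daughter-bisimilar x y c with daughter-point (sub y) c
... | q , bq , e = graft y q , below-graft y bq , sameSub⇒bisimilar x (graft y q) (sym (trans (sub-graft y q) e))

iter : ℕ → Tree → Maybe Tree
iter zero T = just T
iter (suc t) T = iter t T >>= succSub

>>=-assoc : ∀ {X Y Z : Set} (m : Maybe X) (f : X → Maybe Y) (g : Y → Maybe Z) →
            ((m >>= f) >>= g) ≡ (m >>= λ x → f x >>= g)
>>=-assoc nothing f g = refl
>>=-assoc (just x) f g = refl

>>=-just : ∀ {X : Set} (m : Maybe X) → (m >>= just) ≡ m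
>>=-just nothing = refl
>>=-just (just x) = refl

iter-suc : ∀ t T → iter (suc t) T ≡ (succSub T >>= iter t)
iter-suc zero T = sym (>>=-just (succSub T))
iter-suc (suc t) T = begin
  (iter (suc t) T >>= succSub)               ≡⟨ cong (_>>= succSub) (iter-suc t T) ⟩
  ((succSub T >>= iter t) >>= succSub)       ≡⟨ >>=-assoc (succSub T) (iter t) succSub ⟩
  (succSub T >>= iter (suc t))               ∎
  where open ≡-Reasoning

iter-addVar : ∀ k t T → iter (suc t) (addVar k T) ≡ iter (suc t) T
iter-addVar k t T = begin
  iter (suc t) (addVar k T)        ≡⟨ iter-suc t (addVar k T) ⟩
  (succSub (addVar k T) >>= iter t) ≡⟨ cong (_>>= iter t) (succSub-addVar k T) ⟩
  (succSub T >>= iter t)            ≡⟨ iter-suc t T ⟨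
  iter (suc t) T                   ∎
  where open ≡-Reasoning

S-iter : ∀ T t → Maybe.map sub (Sᵗ (treeModel T) t here) ≡ iter t T
S-iter T zero = refl
S-iter T (suc t) = step (Sᵗ (treeModel T) t here) (S-iter T t)
  where
  rootSucc-sub : ∀ U → Maybe.map sub (rootSucc U) ≡ succSub U
  rootSucc-sub (node ps cs (just c)) = refl
  rootSucc-sub (node ps cs nothing) = refl
  step : (m : Maybe (Pos T)) → Maybe.map sub m ≡ iter t T →
         Maybe.map sub (m >>= S (treeModel T)) ≡ (iter t T >>= succSub)
  step nothing e = cong (_>>= succSub) e
  step (just p) e = begin
    Maybe.map sub (Maybe.map (graft p) (rootSucc (sub p)))  ≡⟨ sub-map-graft (rootSucc (sub p)) ⟩
    Maybe.map sub (rootSucc (sub p))                        ≡⟨ rootSucc-sub (sub p) ⟩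
    succSub (sub p)                                         ≡⟨ cong (_>>= succSub) e ⟩
    (iter t T >>= succSub)                                  ∎
    where
    open ≡-Reasoning
    sub-map-graft : (m : Maybe (Pos (sub p))) → Maybe.map sub (Maybe.map (graft p) m) ≡ Maybe.map sub m
    sub-map-graft nothing = refl
    sub-map-graft (just q) = cong just (sub-graft p q)

S⇒iter : ∀ T t {p} → Sᵗ (treeModel T) t here ≡ just p → iter t T ≡ just (sub p)
S⇒iter T t e = trans (sym (S-iter T t)) (cong (Maybe.map sub) e)

iter⇒S : ∀ T t {U} → iter t T ≡ just U → Σ (Pos T) λ p → Sᵗ (treeModel T) t here ≡ just p × sub p ≡ U
iter⇒S T t e = fromMap (Sᵗ (treeModel T) t here) (trans (S-iter T t) e)
  where
  fromMap : (m : Maybe (Pos T)) → ∀ {U} → Maybe.map sub m ≡ just U → Σ (Pos T) λ p → m ≡ just p × sub p ≡ U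
  fromMap (just p) refl = p , refl , refl

-- Twins: claims (i) and (ii)

-- Twin A B: the shape shared by every pair (Aⁿᵢ , Bⁿᵢ).
data Twin : Tree → Tree → Set where
  tleaf : ∀ L L′ → Twin (node L [] nothing) (node L′ [] nothing)
  tcomp : ∀ L A′ B′ rest → Twin A′ B′ →
          (∀ X → succSub A′ ≡ just X → ChildIdx rest X) →
          Twin (node L (A′ ∷ B′ ∷ rest) (just zero)) (node L (B′ ∷ rest) (just zero))

twin-addVar : ∀ k {A B} → Twin A B → Twin (addVar k A) (addVar k B)
twin-addVar k (tleaf L L′) = tleaf _ _
twin-addVar k (tcomp L A′ B′ rest t c) = tcomp _ A′ B′ rest t c

mutual
  twin-low : ∀ n i → 1 ≤ i → i ≤ 2 ^ n → Twin (proj₁ (low n i)) (proj₂ (low n i))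
  twin-low zero i _ _ = tleaf _ _
  twin-low (suc n) i h1 h2 = twin-addVar (suc (suc n)) (twin-gen n i h1 h2)

  twin-gen : ∀ n i → 1 ≤ i → i ≤ 2 ^ suc n → Twin (proj₁ (gen n i)) (proj₂ (gen n i))
  twin-gen n i h1 h2 with i ≤? 2 ^ n
  ... | yes p = twin-low n i h1 p
  ... | no np = tcomp [] _ _ (restT n) (twin-low n j (high-pos n i np) (high-bound n i h2))
                  (succ-in-rest n j (high-pos n i np) (high-bound n i h2))
    where j = i ∸ 2 ^ n

twin-iter : ∀ r {A B A′ B′} → Twin A B → iter r A ≡ just A′ → iter r B ≡ just B′ → Twin A′ B′
twin-iter zero tw refl refl = tw
twin-iter (suc r) {A} (tleaf L L′) eA eB with () ← trans (sym (iter-suc r A)) eA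
twin-iter (suc r) {A} {B} (tcomp L A′ B′ rest tw c) eA eB =
  twin-iter r tw (trans (sym (iter-suc r A)) eA) (trans (sym (iter-suc r B)) eB)

twin-daughter-forth : ∀ {A B} → Twin A B → (q : Pos A) → Below here q → ¬ rootSucc A ≡ just q →
                      Σ (Pos B) λ q′ → Below here q′ × sub q ≡ sub q′
twin-daughter-forth (tcomp L A′ B′ rest tw c) (there zero here) (b-here _ _) ne = ⊥-elim (ne refl)
twin-daughter-forth (tcomp L A′ B′ rest (tleaf _ _) c) (there zero (there () p)) (b-here _ _) ne
twin-daughter-forth (tcomp L _ _ rest (tcomp L′ A″ B″ rest′ tw′ c′) c) (there zero (there zero p)) (b-here _ _) ne
  with c A″ refl
... | k , e = there (suc k) (transport (sym e) p) , b-here (suc k) _ , sym (sub-transport (sym e) p)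
twin-daughter-forth (tcomp L _ _ rest (tcomp L′ A″ B″ rest′ tw′ c′) c) (there zero (there (suc d) p)) (b-here _ _) ne =
  there zero (there d p) , b-here zero _ , refl
twin-daughter-forth (tcomp L A′ B′ rest tw c) (there (suc zero) p) (b-here _ _) ne = there zero p , b-here zero p , refl
twin-daughter-forth (tcomp L A′ B′ rest tw c) (there (suc (suc k)) p) (b-here _ _) ne =
  there (suc k) p , b-here (suc k) p , refl

twin-daughter-back : ∀ {A B} → Twin A B → (q′ : Pos B) → Below here q′ → Σ (Pos A) λ q → Below here q × sub q ≡ sub q′
twin-daughter-back (tleaf L L′) (there () p) (b-here _ _)
twin-daughter-back (tcomp L A′ B′ rest tw c) (there zero p) (b-here _ _) = there (suc zero) p , b-here (suc zero) p , refl
twin-daughter-back (tcomp L A′ B′ rest tw c) (there (suc k) p) (b-here _ _) =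
  there (suc (suc k)) p , b-here (suc (suc k)) p , refl

twin-forth : ∀ {T U} {a : Pos T} {b : Pos U} → Twin (sub a) (sub b) →
             ∀ a′ → Below a a′ → just a′ ≢ S (treeModel T) a →
             Σ (Pos U) λ b′ → Below b b′ × LocallyBisimilar (treeModel T , a′) (treeModel U , b′)
twin-forth {a = a} {b} tw a′ Ra ne with below-split Ra
... | q , bq , refl with twin-daughter-forth tw q bq (λ e → ne (cong (Maybe.map (graft a)) (sym e)))
... | q′ , bq′ , e = graft b q′ , below-graft b bq′ , graft-bisimilar a b e

twin-back : ∀ {T U} {a : Pos T} {b : Pos U} → Twin (sub a) (sub b) →
            ∀ b′ → Below b b′ →
            Σ (Pos T) λ a′ → Below a a′ × LocallyBisimilar (treeModel T , a′) (treeModel U , b′)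
twin-back {a = a} {b} tw b′ Rb with below-split Rb
... | q′ , bq′ , refl with twin-daughter-back tw q′ bq′
... | q , bq , e = graft a q , below-graft a bq , graft-bisimilar a b e

twin-at : ∀ n i r → 1 ≤ i → i ≤ 2 ^ suc n → ∀ {a b} →
          Sᵗ (𝒜 (suc n) i) r here ≡ just a → Sᵗ (ℬ (suc n) i) r here ≡ just b → Twin (sub a) (sub b)
twin-at n i r h1 h2 ea eb = twin-iter r (twin-gen n i h1 h2) (S⇒iter (A (suc n) i) r ea) (S⇒iter (B (suc n) i) r eb)

-- Claim (iii) on trees

SameLabels : Tree → Tree → Set
SameLabels T U = ∀ k → (k ∈ labels T) ⇔ (k ∈ labels U)

AgreeBefore : ℕ → Tree → Tree → Set
AgreeBefore r T U = ∀ t → t < r → ∀ T′ U′ → iter t T ≡ just T′ → iter t U ≡ just U′ → SameLabels T′ U′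

DifferAt : ℕ → Tree → Tree → Set
DifferAt r T U = ∀ T′ U′ → iter r T ≡ just T′ → iter r U ≡ just U′ → ¬ SameLabels T′ U′

SuccessorIsDaughter : Tree → Tree → Set
SuccessorIsDaughter A B = ∀ r X Y → iter (suc r) A ≡ just X → iter r B ≡ just Y →
                          AgreeBefore r A B → DifferAt r A B → ChildOf X Y

sameLabels-addVar : ∀ k A B → SameLabels A B → SameLabels (addVar k A) (addVar k B)
sameLabels-addVar k (node ps cs s) (node ps′ cs′ s′) same x =
  mk⇔ (cons (Equivalence.to (same x))) (cons (Equivalence.from (same x)))
  where
  cons : ∀ {L L′ : List ℕ} → (x ∈ L → x ∈ L′) → x ∈ k ∷ L → x ∈ k ∷ L′
  cons f (here e) = here e
  cons f (there m) = there (f m)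

sameLabels-removeVar : ∀ k A B → ¬ k ∈ labels A → ¬ k ∈ labels B →
                       SameLabels (addVar k A) (addVar k B) → SameLabels A B
sameLabels-removeVar k (node ps cs s) (node ps′ cs′ s′) nA nB same x =
  mk⇔ (peel nA (Equivalence.to (same x))) (peel nB (Equivalence.from (same x)))
  where
  peel : ∀ {L L′ : List ℕ} → ¬ k ∈ L → (x ∈ k ∷ L → x ∈ k ∷ L′) → x ∈ L → x ∈ L′
  peel nk f m with f (there m)
  ... | here refl = ⊥-elim (nk m)
  ... | there m′ = m′

mutual
  fresh-low : ∀ n i k → suc n < k → (¬ k ∈ labels (proj₁ (low n i))) × (¬ k ∈ labels (proj₂ (low n i)))
  fresh-low zero i k lt = (λ { (here refl) → <-irrefl refl lt ; (there ()) }) , (λ ())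
  fresh-low (suc n) i k lt with fresh-gen n i k (≤-trans (n≤1+n _) lt)
  ... | nA , nB = fresh-addVar (proj₁ (gen n i)) nA , fresh-addVar (proj₂ (gen n i)) nB
    where
    fresh-addVar : ∀ T → ¬ k ∈ labels T → ¬ k ∈ labels (addVar (suc (suc n)) T)
    fresh-addVar (node ps cs s) nT (here refl) = <-irrefl refl lt
    fresh-addVar (node ps cs s) nT (there m) = nT m

  fresh-gen : ∀ n i k → suc n < k → (¬ k ∈ labels (proj₁ (gen n i))) × (¬ k ∈ labels (proj₂ (gen n i)))
  fresh-gen n i k lt with i ≤? 2 ^ n
  ... | yes _ = fresh-low n i k lt
  ... | no _ = (λ ()) , (λ ())

daughter-addVar : ∀ k A B → ¬ k ∈ labels A → ¬ k ∈ labels B →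
                  SuccessorIsDaughter A B → SuccessorIsDaughter (addVar k A) (addVar k B)
daughter-addVar k A B nA nB ih zero X Y eX refl ag df =
  asDaughterOf B (ih zero X B (trans (sym (iter-addVar k 0 A)) eX) refl (λ t ()) df₀)
  where
  df₀ : DifferAt 0 A B
  df₀ _ _ refl refl same = df _ _ refl refl (sameLabels-addVar k A B same)
  asDaughterOf : ∀ U → ChildOf X U → ChildOf X (addVar k U)
  asDaughterOf (node ps cs s) c = c
daughter-addVar k A B nA nB ih (suc r) X Y eX eY ag df =
  ih (suc r) X Y (trans (sym (iter-addVar k (suc r) A)) eX) (trans (sym (iter-addVar k r B)) eY) ag′ df′
  where
  ag′ : AgreeBefore (suc r) A B
  ag′ zero lt _ _ refl refl = sameLabels-removeVar k A B nA nB (ag zero lt _ _ refl refl)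
  ag′ (suc t) lt T′ U′ eT eU =
    ag (suc t) lt T′ U′ (trans (iter-addVar k t A) eT) (trans (iter-addVar k t B) eU)
  df′ : DifferAt (suc r) A B
  df′ T′ U′ eT eU = df T′ U′ (trans (iter-addVar k r A) eT) (trans (iter-addVar k r B) eU)

addVar-labels : ∀ k T → k ∈ labels (addVar k T)
addVar-labels k (node ps cs s) = here refl

-- A from case (i) against B from case (ii): only r = 0 is possible, since p_{n+2}
-- holds at the root of A only, and S[A] is one of the shared daughters of B
daughter-low-high : ∀ n i j → 1 ≤ i → i ≤ 2 ^ suc n →
                    SuccessorIsDaughter (proj₁ (low (suc n) i)) (compB (suc n) j)
daughter-low-high n i j h1 h2 zero X Y eX refl ag df with succ-in-rest (suc n) i h1 h2 X eX
... | k , e = suc k , e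
daughter-low-high n i j h1 h2 (suc r) X Y eX eY ag df
  with Equivalence.to (ag zero (s≤s z≤n) _ _ refl refl (suc (suc n))) (addVar-labels (suc (suc n)) (proj₁ (gen n i)))
... | ()

-- two trees with the same root label whose successors are the first daughters:
-- distinction happens one step further down the branch
daughter-shift : ∀ L A B cs cs′ → SuccessorIsDaughter A B →
                 SuccessorIsDaughter (node L (A ∷ cs) (just zero)) (node L (B ∷ cs′) (just zero))
daughter-shift L A B cs cs′ ih zero X Y eX eY ag df = ⊥-elim (df _ _ refl refl (λ k → mk⇔ (λ x → x) (λ x → x)))
daughter-shift L A B cs cs′ ih (suc r) X Y eX eY ag df = ih r X Y eX′ eY′ ag′ df′
  where
  TA = node L (A ∷ cs) (just zero)
  TB = node L (B ∷ cs′) (just zero)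
  eX′ = trans (sym (iter-suc (suc r) TA)) eX
  eY′ = trans (sym (iter-suc r TB)) eY
  ag′ : AgreeBefore r A B
  ag′ t lt T U eT eU = ag (suc t) (s≤s lt) T U (trans (iter-suc t TA) eT) (trans (iter-suc t TB) eU)
  df′ : DifferAt r A B
  df′ T U eT eU = df T U (trans (iter-suc r TA) eT) (trans (iter-suc r TB) eU)

daughter-low : ∀ n i j → SuccessorIsDaughter (proj₁ (gen n i)) (proj₂ (gen n j)) →
               SuccessorIsDaughter (proj₁ (low (suc n) i)) (proj₂ (low (suc n) j))
daughter-low n i j = daughter-addVar (suc (suc n)) _ _ (proj₁ (fresh-gen n i (suc (suc n)) (n<1+n _)))
                       (proj₂ (fresh-gen n j (suc (suc n)) (n<1+n _)))

daughter-gen : ∀ n i j → 1 ≤ i → i < j → j ≤ 2 ^ suc n → SuccessorIsDaughter (proj₁ (gen n i)) (proj₂ (gen n j))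
daughter-gen zero (suc (suc i)) j h1 lt h2 with ≤-trans lt h2
... | s≤s (s≤s ())
daughter-gen zero (suc zero) j h1 lt h2 r X Y eX _ _ _ with () ← trans (sym (iter-suc r _)) eX
daughter-gen (suc n) i j h1 lt h2 with i ≤? 2 ^ suc n | j ≤? 2 ^ suc n
... | yes p | yes p′ =
  daughter-low n i j (daughter-gen n i j h1 lt p′)
... | yes p | no _ = daughter-low-high n i (j ∸ 2 ^ suc n) h1 p
... | no np | yes p′ = ⊥-elim (np (≤-trans (<⇒≤ lt) p′))
... | no np | no _ =
  daughter-shift [] _ _ _ _
    (daughter-low n i′ j′
      (daughter-gen n i′ j′ (high-pos (suc n) i np) (high-mono (suc n) i j np lt) (high-bound (suc n) j h2)))
  where
  i′ = i ∸ 2 ^ suc n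
  j′ = j ∸ 2 ^ suc n

distinction-on-trees : ∀ T U r → Distinguishes r (treeModel T , here) (treeModel U , here) →
                       AgreeBefore r T U × DifferAt r T U
distinction-on-trees T U r ((x , y , ex , ey , k , nk) , agree) = agree′ , differ
  where
  agree′ : AgreeBefore r T U
  agree′ t lt T′ U′ eT eU with iter⇒S T t eT | iter⇒S U t eU
  ... | p , ep , refl | q , eq , refl = agree t lt p q ep eq
  differ : DifferAt r T U
  differ T′ U′ eT eU same with trans (sym eT) (S⇒iter T r ex) | trans (sym eU) (S⇒iter U r ey)
  ... | refl | refl = nk (same k)

lemma7p12 : ∀ n r → 1 ≤ n →
    (∀ i → 1 ≤ i → i ≤ 2 ^ n →
    ∀ a b → Sᵗ (𝒜 n i) r (aRoot n i) ≡ just a → Sᵗ (ℬ n i) r (bRoot n i) ≡ just b →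
    ∀ a′ → R (𝒜 n i) a a′ → just a′ ≢ S (𝒜 n i) a →
    Σ (W (ℬ n i)) λ b′ → R (ℬ n i) b b′ × LocallyBisimilar (𝒜 n i , a′) (ℬ n i , b′))
    ×
    (∀ i → 1 ≤ i → i ≤ 2 ^ n →
    ∀ a b → Sᵗ (𝒜 n i) r (aRoot n i) ≡ just a → Sᵗ (ℬ n i) r (bRoot n i) ≡ just b →
    ∀ b′ → R (ℬ n i) b b′ →
    Σ (W (𝒜 n i)) λ a′ → R (𝒜 n i) a a′ × LocallyBisimilar (𝒜 n i , a′) (ℬ n i , b′))
    ×
    (∀ i j → 1 ≤ i → i < j → j ≤ 2 ^ n → ∀ m →
    CriticalHeight (𝒜 n i , aRoot n i) m → CriticalHeight (ℬ n j , bRoot n j) m → r < m →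
    Distinguishes r (𝒜 n i , aRoot n i) (ℬ n j , bRoot n j) →
    ∀ x y → Sᵗ (𝒜 n i) (suc r) (aRoot n i) ≡ just x → Sᵗ (ℬ n j) r (bRoot n j) ≡ just y →
    Σ (W (ℬ n j)) λ b′ → R (ℬ n j) y b′ × LocallyBisimilar (𝒜 n i , x) (ℬ n j , b′))
-- (i) and (ii) hold because S^r[aⁿᵢ], S^r[bⁿᵢ] generate twins; (iii) holds as soon
-- as S^{r+1}[aⁿᵢ] exists.
lemma7p12 (suc n) r _ =
  (λ i h1 h2 a b ea eb → twin-forth (twin-at n i r h1 h2 ea eb)) ,
  (λ i h1 h2 a b ea eb → twin-back (twin-at n i r h1 h2 ea eb)) ,
  (λ i j h1 lt h2 _ _ _ _ dist x y ex ey →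
     daughter-bisimilar x y
       (uncurry (daughter-gen n i j h1 lt h2 r (sub x) (sub y)
                  (S⇒iter (A (suc n) i) (suc r) ex) (S⇒iter (B (suc n) j) r ey))
                (distinction-on-trees (A (suc n) i) (B (suc n) j) r dist)))
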